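{- Let $P$ be an instance of the Generalized Minimum Manhattan Network problem and let $\mathcal{T}=(T,(X_t)_{t\in V(T)})$ be a rooted tree decomposition of the intersection graph $\mathrm{IG}[P]$. Fix a node $t\in V(T)$ and let $P_t$ be the union of all bags $X_{t'}$ over nodes $t'$ in the subtree of $T$ rooted at $t$. Let $N_1=(\pi^{(1)}_w)_{w\in P}$ and $N_2=(\pi^{(2)}_w)_{w\in P}$ be in $\mathrm{Feas}(P)$ with $N_1[X_t]=N_2[X_t]$. If $\|N_1[P_t]\|<\|N_2[P_t]\|$, then $N_2\notin\mathrm{Opt}(P)$.
   Context: A Manhattan path (M-path) for $(s,t)$ is an $s$–$t$ path of axis-aligned segments of total length $|s_x-t_x|+|s_y-t_y|$. The Hanan grid $\mathcal{H}(P)$ is the grid network whose vertex set is $X\times Y$, where $X$ (resp. $Y$) is the set of all $x$- (resp. $y$-) coordinates of points appearing in pairs of $P$, with edges joining consecutive grid vertices. $\Pi_P(v)$ is the set of M-paths for $v$ that are subgraphs of $\mathcal{H}(P)$. $\mathrm{Feas}(P)=\prod_{v\in P}\Pi_P(v)$; a tuple $N=(\pi_v)_{v\in P}$ is identified with the network $\bigcup_{v\in P}\pi_v$ (union of vertex and edge sets), and $\|N\|$ is its total edge length. $\mathrm{Opt}(P)$ is the set of $N\in\mathrm{Feas}(P)$ minimizing $\|N\|$. For $S\subseteq P$, $N[S]=\bigcup_{v\in S}\pi_v$. The bounding box $B(v)$ of $v=(p,q)$ is the axis-parallel rectangle with corners $p,q$; $\mathcal{H}(P,v)$ is the subgraph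 of $\mathcal{H}(P)$ induced by grid vertices in $B(v)$; $\mathrm{IG}[P]$ has vertex set $P$ with $u\ne v$ adjacent iff $\mathcal{H}(P,u),\mathcal{H}(P,v)$ share an edge. A tree decomposition of a graph $G$ is a tree $T$ with bags $X_t\subseteq V(G)$ such that every vertex lies in some bag, every edge has both ends in some bag, and for each vertex the nodes whose bags contain it form a connected subtree.
   Formalization: The points appearing in the pairs of P have rational coordinates. -}

module Defs where

open import Data.Nat using (ℕ; _≤_)
open import Data.Fin using (Fin)
open import Data.Fin.Subset using (Subset; _∈_)
open import Data.Fin.Subset.Properties using (_∈?_)
open import Data.Rational using (ℚ; 0ℚ; _+_; _-_; ∣_∣; _⊓_; _⊔_; _<_) renaming (_≤_ to _≤ℚ_)
open import Data.Rational.Properties using () renaming (_≟_ to _≟ℚ_)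
open import Data.Product using (Σ; ∃; ∃-syntax; _×_; _,_; proj₁; proj₂; swap)
open import Data.Product.Properties using (≡-dec)
open import Data.Sum using (_⊎_)
open import Data.List using (List; []; _∷_; length; concatMap; filter; map; foldr; deduplicate)
open import Data.List.Membership.Propositional using () renaming (_∈_ to _∈L_)
open import Data.List.Relation.Unary.All using (All)
open import Data.List.Relation.Unary.Unique.Propositional using (Unique)
open import Data.Empty using (⊥)
open import Relation.Nullary using (¬_; Dec; _⊎-dec_)
open import Relation.Binary.PropositionalEquality using (_≡_; _≢_)
open import Relation.Binary.Definitions using (DecidableEquality)
open import Function.Bundles using (_⇔_)

Point : Set
Point = ℚ × ℚ

Pair : Set
Pair = Point × Point

px : Point → ℚ
px = proj₁

py : Point → ℚ
py = proj₂

dist : Point → Point → ℚ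
dist a b = ∣ px a - px b ∣ + ∣ py a - py b ∣

data Walk {A : Set} (R : A → A → Set) : A → A → Set where
  stop : ∀ {a} → Walk R a a
  step : ∀ {a b c} → R a b → Walk R b c → Walk R a c

verts : ∀ {A : Set} {R : A → A → Set} {a b : A} → Walk R a b → List A
verts {a = a} stop = a ∷ []
verts {a = a} (step _ w) = a ∷ verts w

edgesW : ∀ {A : Set} {R : A → A → Set} {a b : A} → Walk R a b → List (A × A)
edgesW stop = []
edgesW {a = a} (step {b = b} _ w) = (a , b) ∷ edgesW w

-- An instance P of GMMN: n pairs, indexed by Fin n (pr injective = P is a set)

module _ {n : ℕ} (pr : Fin n → Pair) where

  xCoords : List ℚ
  xCoords = concatMap (λ i → px (proj₁ (pr i)) ∷ px (proj₂ (pr i)) ∷ []) (Data.List.Base.allFin n)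
    where import Data.List.Base

  yCoords : List ℚ
  yCoords = concatMap (λ i → py (proj₁ (pr i)) ∷ py (proj₂ (pr i)) ∷ []) (Data.List.Base.allFin n)
    where import Data.List.Base

  GridVertex : Point → Set
  GridVertex a = (px a ∈L xCoords) × (py a ∈L yCoords)

  -- an edge of H(P) joining consecutive grid vertices, oriented from the
  -- smaller to the larger endpoint
  HEdge : Point → Point → Set
  HEdge a b = GridVertex a × GridVertex b ×
    ( ( (py a ≡ py b) × (px a < px b)
        × (∀ x → x ∈L xCoords → ¬ ((px a < x) × (x < px b))) )
    ⊎ ( (px a ≡ px b) × (py a < py b)
        × (∀ y → y ∈L yCoords → ¬ ((py a < y) × (y < py b))) ) )

  HAdj : Point → Point → Set
  HAdj a b = HEdge a b ⊎ HEdge b a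

  walkLen : ∀ {a b} → Walk HAdj a b → ℚ
  walkLen stop = 0ℚ
  walkLen (step {a} {b} _ w) = dist a b + walkLen w

  MPath : Pair → Set
  MPath (p , q) = Σ (Walk HAdj p q) (λ w → walkLen w ≡ dist p q)

  Feas : Set
  Feas = (i : Fin n) → MPath (pr i)

  VertIn : Feas → Subset n → Point → Set
  VertIn N S a = ∃[ i ] (i ∈ S) × (a ∈L verts (proj₁ (N i)))

  EdgeIn : Feas → Subset n → Point → Point → Set
  EdgeIn N S a b = ∃[ i ] (i ∈ S) ×
    (((a , b) ∈L edgesW (proj₁ (N i))) ⊎ ((b , a) ∈L edgesW (proj₁ (N i))))

  SameSub : Feas → Feas → Subset n → Set
  SameSub N N' S = (∀ a → VertIn N S a ⇔ VertIn N' S a)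
                 × (∀ a b → EdgeIn N S a b ⇔ EdgeIn N' S a b)

  -- ‖N[S]‖: total length of the edge set of N[S], each (undirected) edge
  -- counted once
  private
    decPoint : DecidableEquality Point
    decPoint = ≡-dec _≟ℚ_ _≟ℚ_

    decSeg : DecidableEquality (Point × Point)
    decSeg = ≡-dec decPoint decPoint

    sameEdge? : (e f : Point × Point) → Dec ((e ≡ f) ⊎ (swap e ≡ f))
    sameEdge? e f = decSeg e f ⊎-dec decSeg (swap e) f

    sumQ : List ℚ → ℚ
    sumQ = foldr _+_ 0ℚ

  allEdges : Feas → Subset n → List (Point × Point)
  allEdges N S = concatMap (λ i → sel i (i ∈? S)) (Data.List.Base.allFin n)
    where
      import Data.List.Base
      sel : (i : Fin n) → Dec (i ∈ S) → List (Point × Point)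
      sel i (Relation.Nullary.yes _) = edgesW (proj₁ (N i))
      sel i (Relation.Nullary.no _) = []
        where import Relation.Nullary

  netLen : Feas → Subset n → ℚ
  netLen N S = sumQ (map (λ e → dist (proj₁ e) (proj₂ e))
                         (deduplicate sameEdge? (allEdges N S)))

  fullNetLen : Feas → ℚ
  fullNetLen N = netLen N Data.Fin.Subset.⊤
    where import Data.Fin.Subset

  IsOpt : Feas → Set
  IsOpt N = ∀ (N' : Feas) → fullNetLen N ≤ℚ fullNetLen N'

  InBox : Pair → Point → Set
  InBox (p , q) a = ((px p ⊓ px q) ≤ℚ px a) × (px a ≤ℚ (px p ⊔ px q))
                  × ((py p ⊓ py q) ≤ℚ py a) × (py a ≤ℚ (py p ⊔ py q))

  -- IG[P]: u ≠ v adjacent iff H(P,u) and H(P,v) share an edge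
  -- (H(P,v) = subgraph of H(P) induced by the grid vertices in B(v))
  IGAdj : Fin n → Fin n → Set
  IGAdj u v = (u ≢ v) × ∃[ a ] ∃[ b ] HEdge a b
    × InBox (pr u) a × InBox (pr u) b × InBox (pr v) a × InBox (pr v) b

module _ {m : ℕ} (E : Fin m → Fin m → Set) where

  SimplePath : Fin m → Fin m → Set
  SimplePath a b = Σ (Walk E a b) (λ w → Unique (verts w))

  HasCycle : Set
  HasCycle = ∃[ a ] ∃[ b ] Σ (SimplePath a b) (λ w → (3 ≤ length (verts (proj₁ w))) × E b a)

  IsTree : Set
  IsTree = (∀ a b → E a b → E b a)
         × (∀ a → ¬ E a a)
         × (∀ a b → Walk E a b)
         × (¬ HasCycle)

  -- in the tree rooted at r, t' lies in the subtree rooted at t iff t lies on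
  -- the (unique) path from r to t'
  InSubtree : (r t t' : Fin m) → Set
  InSubtree r t t' = Σ (SimplePath r t') (λ w → t ∈L verts (proj₁ w))

  IsTreeDecomp : {n : ℕ} → (pr : Fin n → Pair) → (Fin m → Subset n) → Set
  IsTreeDecomp {n} pr X =
      (∀ (v : Fin n) → ∃[ t ] v ∈ X t)
    × (∀ (u v : Fin n) → IGAdj pr u v → ∃[ t ] (u ∈ X t) × (v ∈ X t))
    × (∀ (v : Fin n) (t₁ t₂ : Fin m) → v ∈ X t₁ → v ∈ X t₂ →
         Σ (Walk E t₁ t₂) (λ w → All (λ s → v ∈ X s) (verts w)))

{-# OPTIONS --safe #-}
module Submission where

-- Splice the networks: keep N₁'s paths for the pairs of P_t and N₂'s paths for all other
-- pairs. An M-path stays inside the bounding box of its pair, so an edge shared by the paths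
-- of w ∈ P_t and u ∉ P_t makes w and u adjacent in IG[P]; the tree decomposition then forces
-- w ∈ X_t, where N₁ and N₂ agree. Hence an edge of N₂[P ∖ P_t] lies in N₁[P_t] exactly when it
-- lies in N₂[P_t], the pairs outside P_t add the same length to both networks, and the
-- spliced network is strictly shorter than N₂.

open import Defs
open import Level using (Level; 0ℓ)
open import Data.Nat using (ℕ; s≤s; z≤n) renaming (_≤_ to _≤ℕ_)
open import Data.Fin using (Fin)
open import Data.Rational using (ℚ; 0ℚ; _+_; _-_; -_; ∣_∣; _⊓_; _⊔_; _<_; _≤_)
open import Data.Rational.Properties
  using (module ≤-Reasoning; ≤-trans; <-trans; <⇒≤; ≰⇒>; ≮⇒≥; _≤?_; <-irrefl; <-≤-trans; ≤-reflexive;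
         +-comm; +-identityˡ; +-inverseʳ; +-assoc; +-mono-≤; +-monoʳ-≤; +-monoˡ-≤; +-monoʳ-<; +-monoˡ-<;
         +-mono-<-≤; +-mono-≤-<; +-0-isCommutativeMonoid; +-0-commutativeMonoid; neg-antimono-<;
         ∣-p∣≡∣p∣; ∣p+q∣≤∣p∣+∣q∣; 0≤p⇒∣p∣≡p; ∣p∣≡p∨∣p∣≡-p; p⊓q≤p; p⊓q≤q; p≤p⊔q; p≤q⊔p)
  renaming (_≟_ to _≟ℚ_)
open import Data.Rational.Solver using (module +-*-Solver)
open import Algebra.Bundles using (CommutativeMonoid)
open import Algebra.Properties.CommutativeSemigroup (CommutativeMonoid.commutativeSemigroup +-0-commutativeMonoid)
  using (interchange)
open import Data.Product using (∃; ∃-syntax; _×_; _,_; proj₁; proj₂; swap)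
open import Data.Product.Properties using (≡-dec)
open import Data.Sum using (_⊎_; inj₁; inj₂)
import Data.Sum as Sum
open import Data.List using (List; []; _∷_; _++_; [_]; length; map; foldr; filter; deduplicate; allFin; concatMap)
open import Data.List.Relation.Unary.Any using (Any; here; there)
import Data.List.Relation.Unary.Any.Properties as Any
open import Data.List.Relation.Unary.All using ([]; _∷_) renaming (lookup to All-lookup)
open import Data.List.Relation.Unary.All.Properties using (¬Any⇒All¬) renaming (++⁻ˡ to All-++⁻ˡ; ++⁻ʳ to All-++⁻ʳ)
open import Data.List.Relation.Unary.AllPairs using ([]; _∷_)
open import Data.List.Membership.Propositional using (find) renaming (_∈_ to _∈L_; _∉_ to _∉L_)
open import Data.List.Membership.Propositional.Properties using (∈-++⁺ˡ; ∈-++⁻)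
import Data.List.Relation.Binary.Permutation.Setoid.Properties as Permutation
open import Data.Empty using (⊥-elim)
open import Function using (_∘_; _∋_; _⇔_; mk⇔; Inverse; Equivalence)
open import Relation.Nullary using (¬_; ¬?; yes; no; _⊎-dec_)
open import Relation.Binary.Bundles using (DecSetoid)
open import Relation.Binary.Structures using (IsEquivalence)
open import Relation.Binary.PropositionalEquality as ≡ using (_≡_; _≢_; refl; sym; trans; cong; cong₂; subst)
open +-*-Solver

-- Lengths of finite sets presented as lists with repetitions

module SetWeight {a ℓ : Level} (DS : DecSetoid a ℓ)
  (len : DecSetoid.Carrier DS → ℚ) (len-cong : ∀ {x y} → DecSetoid._≈_ DS x y → len x ≡ len y) where

  open DecSetoid DS using (_≟_; setoid) renaming (Carrier to A; refl to ≈-refl; sym to ≈-sym; trans to ≈-trans)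
  open import Data.List.Membership.DecSetoid DS using (_∈_; _∉_; _∈?_)
  open import Data.List.Membership.Setoid.Properties
    using (∈-∃++; ∈-deduplicate⁺; ∈-deduplicate⁻; ∈-filter⁺; ∈-filter⁻; ∉-resp-≈)
  open import Data.List.Relation.Unary.Unique.Setoid setoid using (Unique)
  open import Data.List.Relation.Unary.Unique.Setoid.Properties using (Unique[x∷xs]⇒x∉xs; ++⁺)
  open import Data.List.Relation.Unary.Unique.DecSetoid.Properties using (deduplicate-!)
  open import Data.List.Relation.Binary.Disjoint.Setoid setoid using (Disjoint)
  open import Data.List.Relation.Binary.Subset.Setoid setoid using (_⊆_)
  open import Data.List.Relation.Binary.Subset.Setoid.Properties
    using (⊆-refl; ⊆-trans; ∷⊈[]; xs⊆x∷xs; ⊆∷∧∉⇒⊆; ⊆-reflexive-↭; filter-⊆) renaming (++⁺ to ⊆-++⁺)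
  open import Data.List.Relation.Binary.Permutation.Setoid setoid
    using (_↭_; ↭-refl; ↭-trans; ↭-sym; ↭-prep; ↭-reflexive-≋)
  open Permutation setoid using (shift; Unique-resp-↭; map⁺)
  open Permutation (≡.setoid ℚ) using (foldr-commMonoid)

  ∈⇒↭-∷ : ∀ {x ys} → x ∈ ys → ∃ λ rest → ys ↭ x ∷ rest
  ∈⇒↭-∷ x∈ys with as , bs , _ , x≈w , ys≋ ← ∈-∃++ setoid x∈ys =
    as ++ bs , ↭-trans (↭-reflexive-≋ ys≋) (shift (≈-sym x≈w) as bs)

  unique-⊆-⊇⇒↭ : ∀ {xs ys} → Unique xs → Unique ys → xs ⊆ ys → ys ⊆ xs → xs ↭ ys
  unique-⊆-⊇⇒↭ {[]}     {[]}    _ _ _ _ = ↭-refl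
  unique-⊆-⊇⇒↭ {[]}     {_ ∷ _} _ _ _ ys⊆[] = ⊥-elim (∷⊈[] setoid ys⊆[])
  unique-⊆-⊇⇒↭ {x ∷ xs} {ys} !x∷xs@(_ ∷ !xs) !ys x∷xs⊆ys ys⊆x∷xs
    with rest , ys↭x∷rest ← ∈⇒↭-∷ (x∷xs⊆ys (here ≈-refl))
    with !x∷rest@(_ ∷ !rest) ← Unique-resp-↭ ys↭x∷rest !ys =
    ↭-trans (↭-prep x (unique-⊆-⊇⇒↭ !xs !rest xs⊆rest rest⊆xs)) (↭-sym ys↭x∷rest)
    where
      xs⊆rest : xs ⊆ rest
      xs⊆rest = ⊆∷∧∉⇒⊆ setoid
        (⊆-trans setoid (xs⊆x∷xs setoid xs x) (⊆-trans setoid x∷xs⊆ys (⊆-reflexive-↭ setoid ys↭x∷rest)))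
        (Unique[x∷xs]⇒x∉xs setoid !x∷xs)
      rest⊆xs : rest ⊆ xs
      rest⊆xs = ⊆∷∧∉⇒⊆ setoid
        (⊆-trans setoid (xs⊆x∷xs setoid rest x) (⊆-trans setoid (⊆-reflexive-↭ setoid (↭-sym ys↭x∷rest)) ys⊆x∷xs))
        (Unique[x∷xs]⇒x∉xs setoid !x∷rest)

  weight : List A → ℚ
  weight xs = foldr _+_ 0ℚ (map len xs)

  weight-↭ : ∀ {xs ys} → xs ↭ ys → weight xs ≡ weight ys
  weight-↭ = foldr-commMonoid +-0-isCommutativeMonoid ∘ map⁺ (≡.setoid ℚ) len-cong

  weight-++ : ∀ xs ys → weight (xs ++ ys) ≡ weight xs + weight ys
  weight-++ []       ys = sym (+-identityˡ (weight ys))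
  weight-++ (x ∷ xs) ys =
    trans (cong (len x +_) (weight-++ xs ys)) (sym (+-assoc (len x) (weight xs) (weight ys)))

  setWeight : List A → ℚ
  setWeight xs = weight (deduplicate _≟_ xs)

  deduplicate-⊆ : ∀ xs → deduplicate _≟_ xs ⊆ xs
  deduplicate-⊆ xs = ∈-deduplicate⁻ setoid _≟_ xs

  ⊆-deduplicate : ∀ xs → xs ⊆ deduplicate _≟_ xs
  ⊆-deduplicate xs = ∈-deduplicate⁺ setoid _≟_ (λ z≈y x≈y → ≈-trans x≈y (≈-sym z≈y))

  deduplicate⁺ : ∀ {xs ys} → xs ⊆ ys → deduplicate _≟_ xs ⊆ deduplicate _≟_ ys
  deduplicate⁺ {xs} {ys} xs⊆ys = ⊆-deduplicate ys ∘ xs⊆ys ∘ deduplicate-⊆ xs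

  setWeight-cong : ∀ {xs ys} → xs ⊆ ys → ys ⊆ xs → setWeight xs ≡ setWeight ys
  setWeight-cong {xs} {ys} xs⊆ys ys⊆xs =
    weight-↭ (unique-⊆-⊇⇒↭ (deduplicate-! DS xs) (deduplicate-! DS ys) (deduplicate⁺ xs⊆ys) (deduplicate⁺ ys⊆xs))

  setWeight-++ : ∀ xs ys → Disjoint xs ys → setWeight (xs ++ ys) ≡ setWeight xs + setWeight ys
  setWeight-++ xs ys xs#ys = trans (weight-↭ (unique-⊆-⊇⇒↭ (deduplicate-! DS (xs ++ ys)) !dxs++dys
      (⊆-trans setoid (deduplicate-⊆ (xs ++ ys)) (⊆-++⁺ setoid (⊆-deduplicate xs) (⊆-deduplicate ys)))
      (⊆-trans setoid (⊆-++⁺ setoid (deduplicate-⊆ xs) (deduplicate-⊆ ys)) (⊆-deduplicate (xs ++ ys)))))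
    (weight-++ (deduplicate _≟_ xs) (deduplicate _≟_ ys))
    where
      !dxs++dys : Unique (deduplicate _≟_ xs ++ deduplicate _≟_ ys)
      !dxs++dys = ++⁺ setoid (deduplicate-! DS xs) (deduplicate-! DS ys)
        λ (v∈xs , v∈ys) → xs#ys (deduplicate-⊆ xs v∈xs , deduplicate-⊆ ys v∈ys)

  _∖_ : List A → List A → List A
  ys ∖ xs = filter (λ y → ¬? (y ∈? xs)) ys

  ∈-∖⁻ : ∀ {z xs} ys → z ∈ ys ∖ xs → z ∈ ys × z ∉ xs
  ∈-∖⁻ {xs = xs} _ = ∈-filter⁻ setoid (λ y → ¬? (y ∈? xs)) (∉-resp-≈ setoid)

  ∈-∖⁺ : ∀ {z xs ys} → z ∈ ys → z ∉ xs → z ∈ ys ∖ xs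
  ∈-∖⁺ {xs = xs} = ∈-filter⁺ setoid (λ y → ¬? (y ∈? xs)) (∉-resp-≈ setoid)

  setWeight-++-∖ : ∀ xs ys → setWeight (xs ++ ys) ≡ setWeight xs + setWeight (ys ∖ xs)
  setWeight-++-∖ xs ys = trans (setWeight-cong forth back)
    (setWeight-++ xs (ys ∖ xs) λ (z∈xs , z∈ys∖xs) → proj₂ (∈-∖⁻ ys z∈ys∖xs) z∈xs)
    where
      forth : xs ++ ys ⊆ xs ++ (ys ∖ xs)
      forth {z} z∈ with Any.++⁻ xs z∈
      ... | inj₁ z∈xs = Any.++⁺ˡ z∈xs
      ... | inj₂ z∈ys with z ∈? xs
      ...   | yes z∈xs = Any.++⁺ˡ z∈xs
      ...   | no  z∉xs = Any.++⁺ʳ xs (∈-∖⁺ z∈ys z∉xs)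
      back : xs ++ (ys ∖ xs) ⊆ xs ++ ys
      back = ⊆-++⁺ setoid (⊆-refl setoid) (filter-⊆ setoid _ ys)

  setWeight-++-monoˡ-< : ∀ {xs ys} zs →
    (∀ {z} → z ∈ zs → z ∈ xs → z ∈ ys) → (∀ {z} → z ∈ zs → z ∈ ys → z ∈ xs) →
    setWeight xs < setWeight ys → setWeight (xs ++ zs) < setWeight (ys ++ zs)
  setWeight-++-monoˡ-< {xs} {ys} zs xs→ys ys→xs xs<ys = begin-strict
    setWeight (xs ++ zs)                   ≡⟨ setWeight-++-∖ xs zs ⟩
    setWeight xs + setWeight (zs ∖ xs)     <⟨ +-monoˡ-< (setWeight (zs ∖ xs)) xs<ys ⟩
    setWeight ys + setWeight (zs ∖ xs)     ≡⟨ cong (setWeight ys +_) (setWeight-cong (∖-mono ys→xs) (∖-mono xs→ys)) ⟩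
    setWeight ys + setWeight (zs ∖ ys)     ≡⟨ setWeight-++-∖ ys zs ⟨
    setWeight (ys ++ zs)                   ∎
    where
      open ≤-Reasoning
      ∖-mono : ∀ {us vs} → (∀ {z} → z ∈ zs → z ∈ vs → z ∈ us) → zs ∖ us ⊆ zs ∖ vs
      ∖-mono vs→us z∈zs∖us with z∈zs , z∉us ← ∈-∖⁻ zs z∈zs∖us = ∈-∖⁺ z∈zs (z∉us ∘ vs→us z∈zs)

open import Data.List.Relation.Unary.Unique.Propositional using (Unique)
import Data.List.Relation.Unary.Unique.Propositional.Properties as Unique
open import Data.List.Relation.Binary.Disjoint.Propositional using (Disjoint)
open import Data.Fin.Subset using (Subset; _∈_; _∉_; ∁; ⊤)
open import Data.Fin.Subset.Properties using (_∈?_; x∈∁p⇒x∉p; x∉p⇒x∈∁p; ∈⊤)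

module _ {A : Set} where

  Unique-++⁻ : ∀ xs {ys : List A} → Unique (xs ++ ys) → Unique xs × Unique ys × Disjoint xs ys
  Unique-++⁻ []       !ys = [] , !ys , λ ()
  Unique-++⁻ (x ∷ xs) (x∉xs++ys ∷ !xs++ys) with !xs , !ys , xs#ys ← Unique-++⁻ xs !xs++ys =
    All-++⁻ˡ xs x∉xs++ys ∷ !xs , !ys , λ where
      (here refl  , v∈ys) → All-lookup (All-++⁻ʳ xs x∉xs++ys) v∈ys refl
      (there v∈xs , v∈ys) → xs#ys (v∈xs , v∈ys)

  Unique-∷ʳ : ∀ {xs} {x : A} → Unique xs → x ∉L xs → Unique (xs ++ [ x ])
  Unique-∷ʳ !xs x∉xs = Unique.++⁺ !xs ([] ∷ []) λ where (v∈xs , here refl) → x∉xs v∈xs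

module _ {A : Set} {R : A → A → Set} where

  tailVerts : ∀ {a b} → Walk R a b → List A
  tailVerts stop       = []
  tailVerts (step _ w) = verts w

  verts≡∷tailVerts : ∀ {a b} (w : Walk R a b) → verts w ≡ a ∷ tailVerts w
  verts≡∷tailVerts stop       = refl
  verts≡∷tailVerts (step _ _) = refl

  start∈verts : ∀ {a b} (w : Walk R a b) → a ∈L verts w
  start∈verts stop       = here refl
  start∈verts (step _ _) = here refl

  end∈verts : ∀ {a b} (w : Walk R a b) → b ∈L verts w
  end∈verts stop       = here refl
  end∈verts (step _ w) = there (end∈verts w)

  _∷ʳʷ_ : ∀ {a b c} → Walk R a b → R b c → Walk R a c
  stop       ∷ʳʷ e = step e stop
  step e′ w  ∷ʳʷ e = step e′ (w ∷ʳʷ e)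

  edgesW-endpoints : ∀ {a b x y} (w : Walk R a b) → (x , y) ∈L edgesW w → R x y × x ∈L verts w × y ∈L verts w
  edgesW-endpoints (step r w) (here refl) = r , here refl , there (start∈verts w)
  edgesW-endpoints (step _ w) (there xy∈w) with r , x∈w , y∈w ← edgesW-endpoints w xy∈w = r , there x∈w , there y∈w

  verts-∷ʳʷ : ∀ {a b c} (w : Walk R a b) (e : R b c) → verts (w ∷ʳʷ e) ≡ verts w ++ [ c ]
  verts-∷ʳʷ stop       e = refl
  verts-∷ʳʷ (step _ w) e = cong (_ ∷_) (verts-∷ʳʷ w e)

  record Split {a c : A} (w : Walk R a c) (x : A) : Set where
    field
      prefix : Walk R a x
      suffix : Walk R x c
      verts-split : verts w ≡ verts prefix ++ tailVerts suffix

  splitAt : ∀ {a c x} (w : Walk R a c) → x ∈L verts w → Split w x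
  splitAt stop       (here refl) = record { prefix = stop ; suffix = stop ; verts-split = refl }
  splitAt (step e w) (here refl) = record { prefix = stop ; suffix = step e w ; verts-split = refl }
  splitAt (step e w) (there x∈w) = record
    { prefix = step e prefix ; suffix = suffix ; verts-split = cong (_ ∷_) verts-split }
    where open Split (splitAt w x∈w)

  module _ {a c x} {w : Walk R a c} (s : Split w x) (!w : Unique (verts w)) where
    open Split s
    private
      parts = Unique-++⁻ (verts prefix) (subst Unique verts-split !w)

    Unique-prefix : Unique (verts prefix)
    Unique-prefix = proj₁ parts

    Unique-suffix : Unique (verts suffix)
    Unique-suffix = subst Unique (sym (verts≡∷tailVerts suffix))
      (¬Any⇒All¬ _ (λ x∈tail → x∉tail (end∈verts prefix , x∈tail)) ∷ proj₁ (proj₂ parts))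
      where x∉tail = proj₂ (proj₂ parts)

  3≤length-verts : ∀ {a b x} (w : Walk R a b) → x ∈L tailVerts w → x ≢ b → 3 ≤ℕ length (verts w)
  3≤length-verts (step _ stop)                (here refl) x≢b = ⊥-elim (x≢b refl)
  3≤length-verts (step _ (step _ stop))       _           _   = s≤s (s≤s (s≤s z≤n))
  3≤length-verts (step _ (step _ (step _ _))) _           _   = s≤s (s≤s (s≤s z≤n))

module _ {m : ℕ} {E : Fin m → Fin m → Set} where
  open import Data.List.Membership.DecPropositional (Data.Fin._≟_ {m}) using () renaming (_∈?_ to _∈L?_)
  open Split

  walk⇒simplePath : ∀ {a b} → Walk E a b → SimplePath E a b
  walk⇒simplePath stop = stop , [] ∷ []
  walk⇒simplePath {a} (step e w) with p , !p ← walk⇒simplePath w with a ∈L? verts p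
  ... | yes a∈p = suffix (splitAt p a∈p) , Unique-suffix (splitAt p a∈p) !p
  ... | no  a∉p = step e p , ¬Any⇒All¬ _ a∉p ∷ !p

  module _ (acyclic : ¬ HasCycle E) where

    -- If b already lies on the path r ⋯ a, cut the path at b: t cannot lie strictly between
    -- b and a, since that segment would close up with the edge a b into a cycle.
    InSubtree-step : ∀ {r t a b} → InSubtree E r t a → E a b → a ≢ t → b ≢ t → InSubtree E r t b
    InSubtree-step {t = t} {b = b} ((p , !p) , t∈p) a→b a≢t b≢t with b ∈L? verts p
    ... | no b∉p =
      (p ∷ʳʷ a→b , subst Unique (sym (verts-∷ʳʷ p a→b)) (Unique-∷ʳ !p b∉p)) ,
      subst (t ∈L_) (sym (verts-∷ʳʷ p a→b)) (∈-++⁺ˡ t∈p)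
    ... | yes b∈p with s ← splitAt p b∈p with ∈-++⁻ (verts (prefix s)) (subst (t ∈L_) (verts-split s) t∈p)
    ...   | inj₁ t∈prefix = (prefix s , Unique-prefix s !p) , t∈prefix
    ...   | inj₂ t∈tail   = ⊥-elim (acyclic (b , _ , (suffix s , Unique-suffix s !p) ,
                                             3≤length-verts (suffix s) t∈tail (λ t≡a → a≢t (sym t≡a)) , a→b))

    InSubtree-walk : ∀ {r t a c} → InSubtree E r t a → (W : Walk E a c) → t ∉L verts W → InSubtree E r t c
    InSubtree-walk sub stop       _   = sub
    InSubtree-walk sub (step e W) t∉W = InSubtree-walk
      (InSubtree-step sub e (λ a≡t → t∉W (here (sym a≡t)))
                            (λ b≡t → t∉W (there (subst (_∈L verts W) b≡t (start∈verts W)))))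
      W (λ t∈W → t∉W (there t∈W))

0<q-p : ∀ {p q} → p < q → 0ℚ < q - p
0<q-p {p} {q} p<q = subst (_< q - p) (+-inverseʳ p) (+-monoˡ-< (- p) p<q)

∣p-q∣≡∣q-p∣ : ∀ p q → ∣ p - q ∣ ≡ ∣ q - p ∣
∣p-q∣≡∣q-p∣ p q = trans (cong ∣_∣ (solve 2 (λ p q → p :- q := :- (q :- p)) refl p q)) (∣-p∣≡∣p∣ (q - p))

∣p-q∣<p+q : ∀ {p q} → 0ℚ < p → 0ℚ < q → ∣ p - q ∣ < p + q
∣p-q∣<p+q {p} {q} 0<p 0<q with ∣p∣≡p∨∣p∣≡-p (p - q)
... | inj₁ ∣p-q∣≡p-q = begin-strict
  ∣ p - q ∣  ≡⟨ ∣p-q∣≡p-q ⟩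
  p - q      <⟨ +-monoʳ-< p (<-trans (neg-antimono-< 0<q) 0<q) ⟩
  p + q      ∎
  where open ≤-Reasoning
... | inj₂ ∣p-q∣≡q-p = begin-strict
  ∣ p - q ∣  ≡⟨ trans ∣p-q∣≡q-p (solve 2 (λ p q → :- (p :- q) := q :- p) refl p q) ⟩
  q - p      <⟨ +-monoʳ-< q (<-trans (neg-antimono-< 0<p) 0<p) ⟩
  q + p      ≡⟨ +-comm q p ⟩
  p + q      ∎
  where open ≤-Reasoning

∣p-r∣≤∣p-q∣+∣q-r∣ : ∀ p q r → ∣ p - r ∣ ≤ ∣ p - q ∣ + ∣ q - r ∣
∣p-r∣≤∣p-q∣+∣q-r∣ p q r = subst (λ d → ∣ d ∣ ≤ ∣ p - q ∣ + ∣ q - r ∣)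
  (solve 3 (λ p q r → (p :- q) :+ (q :- r) := p :- r) refl p q r) (∣p+q∣≤∣p∣+∣q∣ (p - q) (q - r))

detour-below : ∀ {a b x} → x < a → x < b → ∣ a - b ∣ < ∣ a - x ∣ + ∣ x - b ∣
detour-below {a} {b} {x} x<a x<b = begin-strict
  ∣ a - b ∣                ≡⟨ cong ∣_∣ (solve 3 (λ a b x → a :- b := (a :- x) :- (b :- x)) refl a b x) ⟩
  ∣ (a - x) - (b - x) ∣    <⟨ ∣p-q∣<p+q (0<q-p x<a) (0<q-p x<b) ⟩
  (a - x) + (b - x)        ≡⟨ cong₂ _+_ (sym (0≤p⇒∣p∣≡p (<⇒≤ (0<q-p x<a))))
                                        (trans (sym (0≤p⇒∣p∣≡p (<⇒≤ (0<q-p x<b)))) (∣p-q∣≡∣q-p∣ b x)) ⟩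
  ∣ a - x ∣ + ∣ x - b ∣    ∎
  where open ≤-Reasoning

detour-above : ∀ {a b x} → a < x → b < x → ∣ a - b ∣ < ∣ a - x ∣ + ∣ x - b ∣
detour-above {a} {b} {x} a<x b<x = begin-strict
  ∣ a - b ∣                ≡⟨ cong ∣_∣ (solve 3 (λ a b x → a :- b := (x :- b) :- (x :- a)) refl a b x) ⟩
  ∣ (x - b) - (x - a) ∣    <⟨ ∣p-q∣<p+q (0<q-p b<x) (0<q-p a<x) ⟩
  (x - b) + (x - a)        ≡⟨ +-comm (x - b) (x - a) ⟩
  (x - a) + (x - b)        ≡⟨ cong₂ _+_ (trans (sym (0≤p⇒∣p∣≡p (<⇒≤ (0<q-p a<x)))) (∣p-q∣≡∣q-p∣ x a))
                                        (sym (0≤p⇒∣p∣≡p (<⇒≤ (0<q-p b<x)))) ⟩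
  ∣ a - x ∣ + ∣ x - b ∣    ∎
  where open ≤-Reasoning

no-detour⇒between : ∀ {a b x} → ∣ a - x ∣ + ∣ x - b ∣ ≤ ∣ a - b ∣ → a ⊓ b ≤ x × x ≤ a ⊔ b
no-detour⇒between {a} {b} {x} no-detour = lower , upper
  where
    lower : a ⊓ b ≤ x
    lower with a ≤? x | b ≤? x
    ... | yes a≤x | _       = ≤-trans (p⊓q≤p a b) a≤x
    ... | no  _   | yes b≤x = ≤-trans (p⊓q≤q a b) b≤x
    ... | no  a≰x | no  b≰x = ⊥-elim (<-irrefl refl (<-≤-trans (detour-below (≰⇒> a≰x) (≰⇒> b≰x)) no-detour))
    upper : x ≤ a ⊔ b
    upper with x ≤? a | x ≤? b
    ... | yes x≤a | _       = ≤-trans x≤a (p≤p⊔q a b)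
    ... | no  _   | yes x≤b = ≤-trans x≤b (p≤q⊔p a b)
    ... | no  x≰a | no  x≰b = ⊥-elim (<-irrefl refl (<-≤-trans (detour-above (≰⇒> x≰a) (≰⇒> x≰b)) no-detour))

+-≤-componentwise : ∀ {u₁ u₂ v₁ v₂} → u₁ + u₂ ≤ v₁ + v₂ → v₁ ≤ u₁ → v₂ ≤ u₂ → u₁ ≤ v₁ × u₂ ≤ v₂
+-≤-componentwise u≤v v₁≤u₁ v₂≤u₂ =
  ≮⇒≥ (λ v₁<u₁ → <-irrefl refl (<-≤-trans (+-mono-<-≤ v₁<u₁ v₂≤u₂) u≤v)) ,
  ≮⇒≥ (λ v₂<u₂ → <-irrefl refl (<-≤-trans (+-mono-≤-< v₁≤u₁ v₂<u₂) u≤v))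

dist-sym : ∀ a b → dist a b ≡ dist b a
dist-sym a b = cong₂ _+_ (∣p-q∣≡∣q-p∣ (px a) (px b)) (∣p-q∣≡∣q-p∣ (py a) (py b))

∣p-p∣≡0 : ∀ p → ∣ p - p ∣ ≡ 0ℚ
∣p-p∣≡0 p = cong ∣_∣ (+-inverseʳ p)

dist-self : ∀ a → dist a a ≡ 0ℚ
dist-self a = cong₂ _+_ (∣p-p∣≡0 (px a)) (∣p-p∣≡0 (py a))

dist-triangle : ∀ a b c → dist a c ≤ dist a b + dist b c
dist-triangle a b c =
  ≤-trans (+-mono-≤ (∣p-r∣≤∣p-q∣+∣q-r∣ (px a) (px b) (px c)) (∣p-r∣≤∣p-q∣+∣q-r∣ (py a) (py b) (py c)))
  (≤-reflexive (interchange (∣ px a - px b ∣) (∣ px b - px c ∣) (∣ py a - py b ∣) (∣ py b - py c ∣)))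

dist-no-detour⇒InBox : ∀ {n} (pr : Fin n → Pair) {p q x} → dist p x + dist x q ≤ dist p q → InBox pr (p , q) x
dist-no-detour⇒InBox _ {p} {q} {x} no-detour =
  let x-no-detour , y-no-detour =
        +-≤-componentwise {∣ px p - px x ∣ + ∣ px x - px q ∣} {∣ py p - py x ∣ + ∣ py x - py q ∣}
          (≤-trans (≤-reflexive (sym (interchange (∣ px p - px x ∣) (∣ py p - py x ∣) (∣ px x - px q ∣) (∣ py x - py q ∣))))
                   no-detour)
          (∣p-r∣≤∣p-q∣+∣q-r∣ (px p) (px x) (px q)) (∣p-r∣≤∣p-q∣+∣q-r∣ (py p) (py x) (py q))
      x-lower , x-upper = no-detour⇒between {px p} {px q} {px x} x-no-detour
      y-lower , y-upper = no-detour⇒between {py p} {py q} {py x} y-no-detour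
  in x-lower , x-upper , y-lower , y-upper

module _ {n : ℕ} (pr : Fin n → Pair) where

  dist≤walkLen : ∀ {a c} (w : Walk (HAdj pr) a c) → dist a c ≤ walkLen pr w
  dist≤walkLen {a}     stop               = ≤-reflexive (dist-self a)
  dist≤walkLen {a} {c} (step {b = b} _ w) = ≤-trans (dist-triangle a b c) (+-monoʳ-≤ (dist a b) (dist≤walkLen w))

  detour≤walkLen : ∀ {a c x} (w : Walk (HAdj pr) a c) → x ∈L verts w → dist a x + dist x c ≤ walkLen pr w
  detour≤walkLen {a} stop (here refl) = ≤-reflexive (cong₂ _+_ (dist-self a) (dist-self a))
  detour≤walkLen {a} {c} w@(step _ _) (here refl) = begin
    dist a a + dist a c  ≡⟨ cong (_+ dist a c) (dist-self a) ⟩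
    0ℚ + dist a c        ≡⟨ +-identityˡ (dist a c) ⟩
    dist a c             ≤⟨ dist≤walkLen w ⟩
    walkLen pr w         ∎
    where open ≤-Reasoning
  detour≤walkLen {a} {c} {x} (step {b = b} _ w) (there x∈w) = begin
    dist a x + dist x c                ≤⟨ +-monoˡ-≤ (dist x c) (dist-triangle a b x) ⟩
    (dist a b + dist b x) + dist x c   ≡⟨ +-assoc (dist a b) (dist b x) (dist x c) ⟩
    dist a b + (dist b x + dist x c)   ≤⟨ +-monoʳ-≤ (dist a b) (detour≤walkLen w x∈w) ⟩
    dist a b + walkLen pr w            ∎
    where open ≤-Reasoning

  MPath-vertex-InBox : ∀ {v x} (π : MPath pr v) → x ∈L verts (proj₁ π) → InBox pr v x
  MPath-vertex-InBox {p , q} (w , length≡dist) x∈w =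
    dist-no-detour⇒InBox pr {p} {q} (subst (_ ≤_) length≡dist (detour≤walkLen w x∈w))

  MPath-edge-InBox : ∀ {v x y} (π : MPath pr v) → (x , y) ∈L edgesW (proj₁ π) →
                     HAdj pr x y × InBox pr v x × InBox pr v y
  MPath-edge-InBox π xy∈π with x~y , x∈π , y∈π ← edgesW-endpoints (proj₁ π) xy∈π =
    x~y , MPath-vertex-InBox π x∈π , MPath-vertex-InBox π y∈π

-- Networks as sets of undirected grid edges

Edge : Set
Edge = Point × Point

_≈ᵉ_ : Edge → Edge → Set
e ≈ᵉ f = (e ≡ f) ⊎ (swap e ≡ f)

≈ᵉ-isEquivalence : IsEquivalence _≈ᵉ_
≈ᵉ-isEquivalence = record { refl = inj₁ refl ; sym = ≈ᵉ-sym ; trans = ≈ᵉ-trans }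
  where
    ≈ᵉ-sym : ∀ {e f} → e ≈ᵉ f → f ≈ᵉ e
    ≈ᵉ-sym (inj₁ refl) = inj₁ refl
    ≈ᵉ-sym (inj₂ refl) = inj₂ refl
    ≈ᵉ-trans : ∀ {e f g} → e ≈ᵉ f → f ≈ᵉ g → e ≈ᵉ g
    ≈ᵉ-trans (inj₁ refl) f≈g         = f≈g
    ≈ᵉ-trans (inj₂ refl) (inj₁ refl) = inj₂ refl
    ≈ᵉ-trans (inj₂ refl) (inj₂ refl) = inj₁ refl

-- The decision procedure is, definitionally, the one netLen deduplicates with; hence
-- netLen pr N S reduces to setWeight (allEdges pr N S) below.
edgeDecSetoid : DecSetoid 0ℓ 0ℓ
edgeDecSetoid = record
  { _≈_ = _≈ᵉ_
  ; isDecEquivalence = record { isEquivalence = ≈ᵉ-isEquivalence ; _≟_ = λ e f → e ≟ f ⊎-dec swap e ≟ f }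
  }
  where
    _≟_ = ≡-dec (≡-dec _≟ℚ_ _≟ℚ_) (≡-dec _≟ℚ_ _≟ℚ_)

edgeLength : Edge → ℚ
edgeLength e = dist (proj₁ e) (proj₂ e)

edgeLength-cong : ∀ {e f} → e ≈ᵉ f → edgeLength e ≡ edgeLength f
edgeLength-cong (inj₁ refl)          = refl
edgeLength-cong {a , b} (inj₂ refl) = dist-sym a b

open SetWeight edgeDecSetoid edgeLength edgeLength-cong
open import Data.List.Membership.Setoid (DecSetoid.setoid edgeDecSetoid) using () renaming (_∈_ to _∈ᵉ_)
open import Data.List.Relation.Binary.Subset.Setoid (DecSetoid.setoid edgeDecSetoid) using () renaming (_⊆_ to _⊆ᵉ_)

module _ {n : ℕ} (pr : Fin n → Pair) where

  pathEdges : Feas pr → Fin n → List Edge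
  pathEdges N i = edgesW (proj₁ (N i))

  private
    Any-concatMap-allFin⁺ : ∀ {B : Set} {P : B → Set} (f : Fin n → List B) i →
                            Any P (f i) → Any P (concatMap f (allFin n))
    Any-concatMap-allFin⁺ f i = Any.concat⁺ ∘ Any.map⁺ ∘ Any.tabulate⁺ i

    Any-concatMap-allFin⁻ : ∀ {B : Set} {P : B → Set} (f : Fin n → List B) →
                            Any P (concatMap f (allFin n)) → ∃ λ i → Any P (f i)
    Any-concatMap-allFin⁻ f = Any.tabulate⁻ ∘ Any.map⁻ ∘ Any.concat⁻ (map f (allFin n))

  -- allEdges selects the paths with a function local to Defs; matching allEdges against
  -- concatMap f (allFin n) names it, so that `with i ∈? S` can abstract the test inside f i.
  ∈ᵉ-allEdges⁺ : ∀ {N S e i} → i ∈ S → e ∈ᵉ pathEdges N i → e ∈ᵉ allEdges pr N S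
  ∈ᵉ-allEdges⁺ {N} {S} {e} {i} i∈S e∈π
    with i ∈? S | (e ∈ᵉ _ → e ∈ᵉ allEdges pr N S) ∋ Any-concatMap-allFin⁺ _ i
  ... | yes _   | into = into e∈π
  ... | no i∉S | _    = ⊥-elim (i∉S i∈S)

  ∈ᵉ-allEdges⁻ : ∀ {N S e} → e ∈ᵉ allEdges pr N S → ∃[ i ] i ∈ S × e ∈ᵉ pathEdges N i
  ∈ᵉ-allEdges⁻ {N} {S} e∈ with Any-concatMap-allFin⁻ _ e∈
  ... | i , e∈sel with i ∈? S | e∈sel
  ...   | yes i∈S | e∈π = i , i∈S , e∈π
  ...   | no  _   | ()

  EdgeIn⇔∈ᵉ-allEdges : ∀ {N S a b} → EdgeIn pr N S a b ⇔ (a , b) ∈ᵉ allEdges pr N S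
  EdgeIn⇔∈ᵉ-allEdges = mk⇔
    (λ (i , i∈S , ab∈π) → ∈ᵉ-allEdges⁺ i∈S (Inverse.to Any.⊎↔ ab∈π))
    (λ ab∈ → let i , i∈S , ab∈π = ∈ᵉ-allEdges⁻ ab∈ in i , i∈S , Inverse.from Any.⊎↔ ab∈π)

  SameSub⇒allEdges-⊆ : ∀ {N N′ S} → SameSub pr N N′ S → allEdges pr N S ⊆ᵉ allEdges pr N′ S
  SameSub⇒allEdges-⊆ (_ , sameEdges) {a , b} =
    Equivalence.to EdgeIn⇔∈ᵉ-allEdges ∘ Equivalence.to (sameEdges a b) ∘ Equivalence.from EdgeIn⇔∈ᵉ-allEdges

  SameSub⇒allEdges-⊇ : ∀ {N N′ S} → SameSub pr N N′ S → allEdges pr N′ S ⊆ᵉ allEdges pr N S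
  SameSub⇒allEdges-⊇ (_ , sameEdges) {a , b} =
    Equivalence.to EdgeIn⇔∈ᵉ-allEdges ∘ Equivalence.from (sameEdges a b) ∘ Equivalence.from EdgeIn⇔∈ᵉ-allEdges

  allEdges-mono : ∀ {N S T} → (∀ {i} → i ∈ S → i ∈ T) → allEdges pr N S ⊆ᵉ allEdges pr N T
  allEdges-mono S⊆T e∈ with i , i∈S , e∈π ← ∈ᵉ-allEdges⁻ e∈ = ∈ᵉ-allEdges⁺ (S⊆T i∈S) e∈π

  ∈ᵉ-MPath⇒InBox : ∀ {v a b} (π : MPath pr v) → (a , b) ∈ᵉ edgesW (proj₁ π) →
                   HAdj pr a b × InBox pr v a × InBox pr v b
  ∈ᵉ-MPath⇒InBox π ab∈π with find ab∈π
  ... | _ , ab∈π′ , inj₁ refl = MPath-edge-InBox pr π ab∈π′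
  ... | _ , ba∈π  , inj₂ refl = swap-ends (MPath-edge-InBox pr π ba∈π)
    where
      swap-ends : ∀ {P : Point → Set} {x y} → HAdj pr x y × P x × P y → HAdj pr y x × P y × P x
      swap-ends (x~y , Px , Py) = Sum.swap x~y , Py , Px

  shared-edge⇒IGAdj : ∀ {u v a b} (π : MPath pr (pr u)) (π′ : MPath pr (pr v)) → u ≢ v →
                      (a , b) ∈ᵉ edgesW (proj₁ π) → (a , b) ∈ᵉ edgesW (proj₁ π′) → IGAdj pr u v
  shared-edge⇒IGAdj π π′ u≢v e∈π e∈π′ with ∈ᵉ-MPath⇒InBox π e∈π | ∈ᵉ-MPath⇒InBox π′ e∈π′
  ... | inj₁ a→b , a∈Bu , b∈Bu | _ , a∈Bv , b∈Bv = u≢v , _ , _ , a→b , a∈Bu , b∈Bu , a∈Bv , b∈Bv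
  ... | inj₂ b→a , a∈Bu , b∈Bu | _ , a∈Bv , b∈Bv = u≢v , _ , _ , b→a , b∈Bu , a∈Bu , b∈Bv , a∈Bv

  Separates : Subset n → Subset n → Set
  Separates B S = ∀ {w u} → w ∈ S → w ∉ B → u ∉ S → ¬ IGAdj pr w u

  shared-edge∈separator : ∀ {B S e} → Separates B S → ∀ N N′ →
    e ∈ᵉ allEdges pr N S → e ∈ᵉ allEdges pr N′ (∁ S) → e ∈ᵉ allEdges pr N B
  shared-edge∈separator {B} {e = a , b} B-separates N N′ e∈NS e∈N′∁S
    with w , w∈S , e∈πw ← ∈ᵉ-allEdges⁻ e∈NS
    with u , u∈∁S , e∈πu ← ∈ᵉ-allEdges⁻ e∈N′∁S
    with w ∈? B
  ... | yes w∈B = ∈ᵉ-allEdges⁺ w∈B e∈πw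
  ... | no  w∉B = ⊥-elim (B-separates w∈S w∉B u∉S (shared-edge⇒IGAdj (N w) (N′ u) w≢u e∈πw e∈πu))
    where
      u∉S = x∈∁p⇒x∉p u∈∁S
      w≢u : w ≢ u
      w≢u refl = u∉S w∈S

  splice : Subset n → Feas pr → Feas pr → Feas pr
  splice S N N′ i with i ∈? S
  ... | yes _ = N i
  ... | no  _ = N′ i

  splice-∈ : ∀ {S N N′ i} → i ∈ S → splice S N N′ i ≡ N i
  splice-∈ {S} {i = i} i∈S with i ∈? S
  ... | yes _   = refl
  ... | no  i∉S = ⊥-elim (i∉S i∈S)

  splice-∉ : ∀ {S N N′ i} → i ∉ S → splice S N N′ i ≡ N′ i
  splice-∉ {S} {i = i} i∉S with i ∈? S
  ... | yes i∈S = ⊥-elim (i∉S i∈S)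
  ... | no  _   = refl

  fullNetLen-piecewise : ∀ {M N N′ S} → (∀ {i} → i ∈ S → M i ≡ N i) → (∀ {i} → i ∉ S → M i ≡ N′ i) →
    fullNetLen pr M ≡ setWeight (allEdges pr N S ++ allEdges pr N′ (∁ S))
  fullNetLen-piecewise {M} {N} {N′} {S} M≡N M≡N′ = setWeight-cong forth back
    where
      along : ∀ {v e} {π π′ : MPath pr v} → π ≡ π′ → e ∈ᵉ edgesW (proj₁ π) → e ∈ᵉ edgesW (proj₁ π′)
      along refl e∈π = e∈π
      forth : allEdges pr M ⊤ ⊆ᵉ allEdges pr N S ++ allEdges pr N′ (∁ S)
      forth e∈ with i , _ , e∈πi ← ∈ᵉ-allEdges⁻ e∈ with i ∈? S
      ... | yes i∈S = Any.++⁺ˡ (∈ᵉ-allEdges⁺ i∈S (along (M≡N i∈S) e∈πi))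
      ... | no  i∉S = Any.++⁺ʳ _ (∈ᵉ-allEdges⁺ (x∉p⇒x∈∁p i∉S) (along (M≡N′ i∉S) e∈πi))
      back : allEdges pr N S ++ allEdges pr N′ (∁ S) ⊆ᵉ allEdges pr M ⊤
      back e∈ with Any.++⁻ (allEdges pr N S) e∈
      ... | inj₁ e∈NS with i , i∈S , e∈πi ← ∈ᵉ-allEdges⁻ e∈NS =
        ∈ᵉ-allEdges⁺ ∈⊤ (along (sym (M≡N i∈S)) e∈πi)
      ... | inj₂ e∈N′∁S with i , i∈∁S , e∈πi ← ∈ᵉ-allEdges⁻ e∈N′∁S =
        ∈ᵉ-allEdges⁺ ∈⊤ (along (sym (M≡N′ (x∈∁p⇒x∉p i∈∁S))) e∈πi)

  splice-shorter : ∀ {B S} (N₁ N₂ : Feas pr) → (∀ {i} → i ∈ B → i ∈ S) → Separates B S → SameSub pr N₁ N₂ B →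
    netLen pr N₁ S < netLen pr N₂ S → fullNetLen pr (splice S N₁ N₂) < fullNetLen pr N₂
  splice-shorter {B} {S} N₁ N₂ B⊆S B-separates N₁≗N₂-on-B shorter = begin-strict
    fullNetLen pr (splice S N₁ N₂)  ≡⟨ fullNetLen-piecewise splice-∈ splice-∉ ⟩
    setWeight (A₁ ++ rest)          <⟨ setWeight-++-monoˡ-< rest
                                         (transfer N₁ N₂ (SameSub⇒allEdges-⊆ N₁≗N₂-on-B))
                                         (transfer N₂ N₁ (SameSub⇒allEdges-⊇ N₁≗N₂-on-B)) shorter ⟩
    setWeight (A₂ ++ rest)          ≡⟨ fullNetLen-piecewise (λ _ → refl) (λ _ → refl) ⟨
    fullNetLen pr N₂                ∎
    where
      open ≤-Reasoning
      A₁ = allEdges pr N₁ S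
      A₂ = allEdges pr N₂ S
      rest = allEdges pr N₂ (∁ S)
      transfer : ∀ N N′ → allEdges pr N B ⊆ᵉ allEdges pr N′ B →
        ∀ {e} → e ∈ᵉ rest → e ∈ᵉ allEdges pr N S → e ∈ᵉ allEdges pr N′ S
      transfer N N′ B-edges e∈rest e∈NS =
        allEdges-mono B⊆S (B-edges (shared-edge∈separator B-separates N N₂ e∈NS e∈rest))

-- Tree decompositions of the intersection graph

module _ {n m : ℕ} {pr : Fin n → Pair} {E : Fin m → Fin m → Set} {root : Fin m} {X : Fin m → Subset n}
         (tree : IsTree E) (decomp : IsTreeDecomp E pr X) (t : Fin m) {Pt : Subset n}
         (Pt-def : ∀ w → (w ∈ Pt) ⇔ (∃[ t′ ] InSubtree E root t t′ × (w ∈ X t′))) where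

  private
    connected = proj₁ (proj₂ (proj₂ tree))
    acyclic = proj₂ (proj₂ (proj₂ tree))
    covers-IG-edges = proj₁ (proj₂ decomp)
    bags-connected = proj₂ (proj₂ decomp)

  bag⊆subtreePairs : ∀ {w} → w ∈ X t → w ∈ Pt
  bag⊆subtreePairs w∈Xt = Equivalence.from (Pt-def _) (t , (root⇝t , end∈verts (proj₁ root⇝t)) , w∈Xt)
    where root⇝t = walk⇒simplePath (connected root t)

  -- The bags containing w connect t′ (below t) to a bag t″ containing u; they avoid X t,
  -- so the walk does not pass through t and t″ is below t too.
  bag-separates-subtreePairs : Separates pr (X t) Pt
  bag-separates-subtreePairs {w} {u} w∈Pt w∉Xt u∉Pt w~u
    with t″ , w∈Xt″ , u∈Xt″ ← covers-IG-edges w u w~u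
    with t′ , t′-below-t , w∈Xt′ ← Equivalence.to (Pt-def w) w∈Pt
    with t′⇝t″ , w∈bags ← bags-connected w t′ t″ w∈Xt′ w∈Xt″ =
    u∉Pt (Equivalence.from (Pt-def u)
      (t″ , InSubtree-walk acyclic t′-below-t t′⇝t″ (λ t∈walk → w∉Xt (All-lookup w∈bags t∈walk)) , u∈Xt″))

mainTheorem8 : ∀ {n : ℕ} (pr : Fin n → Pair) →
    (∀ i j → pr i ≡ pr j → i ≡ j) →
    ∀ {m : ℕ} (E : Fin m → Fin m → Set) (root : Fin m) (X : Fin m → Subset n) →
    IsTree E → IsTreeDecomp E pr X →
    ∀ (t : Fin m) (Pt : Subset n) →
    (∀ w → (w ∈ Pt) ⇔ (∃[ t' ] InSubtree E root t t' × (w ∈ X t'))) →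
    ∀ (N₁ N₂ : Feas pr) →
    SameSub pr N₁ N₂ (X t) →
    netLen pr N₁ Pt < netLen pr N₂ Pt →
    ¬ IsOpt pr N₂
mainTheorem8 pr _ E root X tree decomp t Pt Pt-def N₁ N₂ N₁≗N₂-on-Xt shorter N₂-optimal =
  <-irrefl refl (<-≤-trans spliced-shorter (N₂-optimal (splice pr Pt N₁ N₂)))
  where
    spliced-shorter : fullNetLen pr (splice pr Pt N₁ N₂) < fullNetLen pr N₂
    spliced-shorter = splice-shorter pr N₁ N₂ (bag⊆subtreePairs tree decomp t Pt-def)
      (bag-separates-subtreePairs tree decomp t Pt-def) N₁≗N₂-on-Xt shorter
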